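{- For every integer $n\ge 0$, $$\beta_{n,\lambda}=\sum_{k=0}^{n}\frac{(-1)^{k}}{k+1}\,k!\,S_{2,\lambda}(n,k)=\sum_{k=0}^{n}\frac{1}{k+1}\sum_{j=0}^{k}\binom{k}{j}(-1)^{j}(j)_{n,\lambda}.$$
   Context: Let $\lambda\in\mathbb{R}$. The degenerate falling factorial is $(x)_{0,\lambda}=1$, $(x)_{n,\lambda}=x(x-\lambda)\cdots(x-(n-1)\lambda)$ for $n\ge1$; the ordinary falling factorial is $(x)_0=1$, $(x)_n=x(x-1)\cdots(x-n+1)$. The degenerate exponential is the formal power series $e_\lambda^x(t)=\sum_{k\ge0}(x)_{k,\lambda}t^k/k!$ and $e_\lambda(t)=e_\lambda^1(t)$. The fully degenerate Bernoulli polynomials $\beta_{n,\lambda}(x)$ are defined by $\frac{\log(1+\lambda t)}{\lambda(e_\lambda(t)-1)}e_\lambda^x(t)=\sum_{n\ge0}\beta_{n,\lambda}(x)\frac{t^n}{n!}$ (for $\lambda=0$ interpret $\log(1+\lambda t)/\lambda$ as $t$ and $e_0^x(t)=e^{xt}$), and $\beta_{n,\lambda}=\beta_{n,\lambda}(0)$ are the fully degenerate Bernoulli numbers. The degenerate Stirling numbers of the second kind $S_{2,\lambda}(n,k)$ are defined by $(x)_{n,\lambda}=\sum_{k=0}^{n}S_{2,\lambda}(n,k)(x)_k$ for $n\ge0$; equivalently $\frac{1}{k!}(e_\lambda(t)-1)^k=\sum_{n\ge k}S_{2,\lambda}(n,k)\frac{t^n}{n!}$.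
   Formalization: The parameter λ ranges over the rationals instead of ℝ. -}

module Defs where

open import Data.Nat as ℕ using (ℕ; zero; suc; _∸_; _!)
open import Data.Nat.Properties using (_!≢0)
open import Data.Nat.Combinatorics using (_C_)
open import Data.Integer using (+_)
open import Data.Rational using (ℚ; 0ℚ; 1ℚ; _+_; _*_; -_; _-_; _/_)
open import Data.List using (List; []; _∷_; _++_)

ℕ→ℚ : ℕ → ℚ
ℕ→ℚ n = + n / 1

inv-suc : ℕ → ℚ
inv-suc n = + 1 / suc n

inv-fact : ℕ → ℚ
inv-fact n = (+ 1 / (n !)) {{n !≢0}}

_^_ : ℚ → ℕ → ℚ
x ^ zero  = 1ℚ
x ^ suc n = (x ^ n) * x

sgn : ℕ → ℚ
sgn k = (- 1ℚ) ^ k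

sumTo : ℕ → (ℕ → ℚ) → ℚ
sumTo zero    f = f zero
sumTo (suc n) f = sumTo n f + f (suc n)

dff : ℚ → ℚ → ℕ → ℚ
dff x λ' zero    = 1ℚ
dff x λ' (suc n) = dff x λ' n * (x - ℕ→ℚ n * λ')

ff : ℚ → ℕ → ℚ
ff x n = dff x 1ℚ n

-- Formal power series over ℚ, represented by coefficient sequences

Series : Set
Series = ℕ → ℚ

_⊛_ : Series → Series → Series
(f ⊛ g) n = sumTo n (λ i → f i * g (n ∸ i))

pow : Series → ℕ → Series
pow f zero    zero    = 1ℚ
pow f zero    (suc n) = 0ℚ
pow f (suc k)         = pow f k ⊛ f

nth : List ℚ → ℕ → ℚ
nth []       _       = 0ℚ
nth (x ∷ xs) zero    = x
nth (x ∷ xs) (suc n) = nth xs n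

-- inverse of a series d with constant term d 0 = 1:
-- invL d n = [inv 0, …, inv n], inv 0 = 1,
-- inv (m+1) = - Σ_{i=0}^{m} d (i+1) * inv (m - i)
invL : Series → ℕ → List ℚ
invL d zero    = 1ℚ ∷ []
invL d (suc n) = invL d n ++ ((- sumTo n (λ i → d (suc i) * nth (invL d n) (n ∸ i))) ∷ [])

inv1 : Series → Series
inv1 d n = nth (invL d n) n

eλ : ℚ → ℚ → Series
eλ λ' x k = dff x λ' k * inv-fact k

eλ-1 : ℚ → Series
eλ-1 λ' zero    = 0ℚ
eλ-1 λ' (suc k) = eλ λ' 1ℚ (suc k)

-- log(1+λt)/(λ t) = Σ_m (-λ)^m t^m/(m+1)   (equals 1 when λ = 0)
logOverλt : ℚ → Series
logOverλt λ' m = ((- λ') ^ m) * inv-suc m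

-- (e_λ(t) - 1)/t
eλ-1-over-t : ℚ → Series
eλ-1-over-t λ' m = eλ λ' 1ℚ (suc m)

-- generating function log(1+λt)/(λ(e_λ(t)-1)) · e_λ^x(t)
--   = (log(1+λt)/(λt)) · ((e_λ(t)-1)/t)⁻¹ · e_λ^x(t)
βgen : ℚ → ℚ → Series
βgen λ' x = (logOverλt λ' ⊛ inv1 (eλ-1-over-t λ')) ⊛ eλ λ' x

βpoly : ℚ → ℕ → ℚ → ℚ
βpoly λ' n x = ℕ→ℚ (n !) * βgen λ' x n

βnum : ℚ → ℕ → ℚ
βnum λ' n = βpoly λ' n 0ℚ

-- degenerate Stirling numbers of the second kind:
-- (1/k!)(e_λ(t)-1)^k = Σ_n S_{2,λ}(n,k) t^n/n!
S2λ : ℚ → ℕ → ℕ → ℚ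
S2λ λ' n k = ℕ→ℚ (n !) * (inv-fact k * pow (eλ-1 λ') k n)

-- Write u = e_λ(t) - 1. As e_λ(t) = (1 + λt)^(1/λ), we have log(1 + λt)/λ = log(1 + u)
-- = Σₖ (-1)ᵏ uᵏ⁺¹/(k + 1), so the generating function log(1 + λt)/(λu) equals
-- Σₖ (-1)ᵏ uᵏ/(k + 1). The coefficient of tⁿ/n! in uᵏ is k! S₂,λ(n, k), which gives the
-- first formula, and (-u)ᵏ = Σⱼ (k choose j) (-1)ʲ e_λ^j(t) with n! [tⁿ] e_λ^j(t) = (j)ₙ,λ
-- gives the second.
--
-- Instead of developing logarithms of formal power series, log(1 + u) = log(1 + λt)/λ is
-- proved with the derivation Dλ = (1 + λt) d/dt: Dλ e_λ^x = x e_λ^x, hence Dλ u = 1 + u, so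
-- both sides have image 1 under Dλ and constant term 0, while a series is determined by its
-- constant term and its image under Dλ - c for any scalar c. The case c = x + y also gives
-- e_λ^(x+y) = e_λ^x e_λ^y.

{-# OPTIONS --safe #-}
module Submission where

open import Data.List using (List; []; _∷_; _++_; length)
open import Data.List.Properties using (length-++)
open import Data.Nat as ℕ using (ℕ; zero; suc; _∸_; _≤_; _<_; z≤n; s≤s; _!; NonZero)
import Data.Nat.Properties as ℕ
open import Data.Nat.Combinatorics using (_C_; k>n⇒nCk≡0; nCk+nC[k+1]≡[n+1]C[k+1])
import Data.Integer as ℤ
import Data.Integer.Properties as ℤ
import Data.Integer.Tactic.RingSolver as ℤ-Solver
open import Data.Product using (_×_; _,_)
open import Data.Rational using (ℚ; 0ℚ; 1ℚ; _+_; _*_; -_; _-_; _/_; fromℚᵘ)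
open import Data.Rational.Properties
  using ( _≟_; +-*-commutativeRing; toℚᵘ-injective; toℚᵘ-fromℚᵘ; toℚᵘ-homo-+; toℚᵘ-homo-*; fromℚᵘ-cong
        ; +-assoc; +-comm; +-identityˡ; +-identityʳ; +-inverseʳ; *-assoc; *-comm; *-identityˡ; *-identityʳ
        ; *-zeroˡ; *-zeroʳ; *-distribˡ-+; *-distribʳ-+ )
import Data.Rational.Unnormalised as ℚᵘ
import Data.Rational.Unnormalised.Properties as ℚᵘ
open import Data.Sum using (inj₁; inj₂)
open import Level using (0ℓ)
open import Relation.Binary.PropositionalEquality
open import Relation.Nullary.Decidable.Core using (dec⇒maybe)
open import Tactic.RingSolver using (solve-∀)
import Tactic.RingSolver.Core.AlmostCommutativeRing as ACR

open import Defs

open ≡-Reasoning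

-- The zero test is not optional: without it the normaliser keeps terms such as x * 0ℚ.
ℚ-ring : ACR.AlmostCommutativeRing 0ℓ 0ℓ
ℚ-ring = ACR.fromCommutativeRing +-*-commutativeRing (λ x → dec⇒maybe (0ℚ ≟ x))

fromℚᵘ-+ : ∀ p q → fromℚᵘ (p ℚᵘ.+ q) ≡ fromℚᵘ p + fromℚᵘ q
fromℚᵘ-+ p q = toℚᵘ-injective (ℚᵘ.≃-trans (toℚᵘ-fromℚᵘ (p ℚᵘ.+ q))
  (ℚᵘ.≃-sym (ℚᵘ.≃-trans (toℚᵘ-homo-+ (fromℚᵘ p) (fromℚᵘ q)) (ℚᵘ.+-cong (toℚᵘ-fromℚᵘ p) (toℚᵘ-fromℚᵘ q)))))

fromℚᵘ-* : ∀ p q → fromℚᵘ (p ℚᵘ.* q) ≡ fromℚᵘ p * fromℚᵘ q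
fromℚᵘ-* p q = toℚᵘ-injective (ℚᵘ.≃-trans (toℚᵘ-fromℚᵘ (p ℚᵘ.* q))
  (ℚᵘ.≃-sym (ℚᵘ.≃-trans (toℚᵘ-homo-* (fromℚᵘ p) (fromℚᵘ q)) (ℚᵘ.*-cong (toℚᵘ-fromℚᵘ p) (toℚᵘ-fromℚᵘ q)))))

-- ℕ→ℚ n is definitionally fromℚᵘ (ℕ→ℚᵘ n).
ℕ→ℚᵘ : ℕ → ℚᵘ.ℚᵘ
ℕ→ℚᵘ n = ℚᵘ.mkℚᵘ (ℤ.+ n) 0

ℕ→ℚ-+ : ∀ m n → ℕ→ℚ (m ℕ.+ n) ≡ ℕ→ℚ m + ℕ→ℚ n
ℕ→ℚ-+ m n = trans (fromℚᵘ-cong {ℕ→ℚᵘ (m ℕ.+ n)} {ℕ→ℚᵘ m ℚᵘ.+ ℕ→ℚᵘ n} (ℚᵘ.*≡* numerators))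
                  (fromℚᵘ-+ (ℕ→ℚᵘ m) (ℕ→ℚᵘ n))
  where
  denominators-1 : ∀ a b → (a ℤ.+ b) ℤ.* ℤ.+ 1 ≡ (a ℤ.* ℤ.+ 1 ℤ.+ b ℤ.* ℤ.+ 1) ℤ.* ℤ.+ 1
  denominators-1 = ℤ-Solver.solve-∀
  numerators : ℤ.+ (m ℕ.+ n) ℤ.* ℤ.+ 1 ≡ (ℤ.+ m ℤ.* ℤ.+ 1 ℤ.+ ℤ.+ n ℤ.* ℤ.+ 1) ℤ.* ℤ.+ 1
  numerators = trans (cong (ℤ._* ℤ.+ 1) (ℤ.pos-+ m n)) (denominators-1 (ℤ.+ m) (ℤ.+ n))

ℕ→ℚ-* : ∀ m n → ℕ→ℚ (m ℕ.* n) ≡ ℕ→ℚ m * ℕ→ℚ n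
ℕ→ℚ-* m n = trans (fromℚᵘ-cong {ℕ→ℚᵘ (m ℕ.* n)} {ℕ→ℚᵘ m ℚᵘ.* ℕ→ℚᵘ n} (ℚᵘ.*≡* (cong (ℤ._* ℤ.+ 1) (ℤ.pos-* m n))))
                  (fromℚᵘ-* (ℕ→ℚᵘ m) (ℕ→ℚᵘ n))

ℕ→ℚ-suc : ∀ n → ℕ→ℚ (suc n) ≡ ℕ→ℚ n + 1ℚ
ℕ→ℚ-suc n = trans (cong ℕ→ℚ (ℕ.+-comm 1 n)) (ℕ→ℚ-+ n 1)

ℕ→ℚ-*-inverse : ∀ m .{{_ : NonZero m}} → ℕ→ℚ m * (ℤ.+ 1 / m) ≡ 1ℚ
ℕ→ℚ-*-inverse (suc n) = trans (sym (fromℚᵘ-* (ℕ→ℚᵘ (suc n)) (ℚᵘ.mkℚᵘ (ℤ.+ 1) n)))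
                              (fromℚᵘ-cong (ℚᵘ.*-inverseʳ (ℕ→ℚᵘ (suc n))))

suc-*-inv-suc : ∀ n → ℕ→ℚ (suc n) * inv-suc n ≡ 1ℚ
suc-*-inv-suc n = ℕ→ℚ-*-inverse (suc n)

!-*-inv-fact : ∀ n → ℕ→ℚ (n !) * inv-fact n ≡ 1ℚ
!-*-inv-fact n = ℕ→ℚ-*-inverse (n !) {{n ℕ.!≢0}}

*-inverse-unique : ∀ m a b → m * a ≡ 1ℚ → m * b ≡ 1ℚ → a ≡ b
*-inverse-unique m a b ma≡1 mb≡1 = begin
  a            ≡⟨ *-identityʳ a ⟨
  a * 1ℚ       ≡⟨ cong (a *_) mb≡1 ⟨
  a * (m * b)  ≡⟨ reassoc a m b ⟩
  (m * a) * b  ≡⟨ cong (_* b) ma≡1 ⟩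
  1ℚ * b       ≡⟨ *-identityˡ b ⟩
  b            ∎
  where
  reassoc : ∀ a m b → a * (m * b) ≡ (m * a) * b
  reassoc = solve-∀ ℚ-ring

suc-*-cancelˡ : ∀ n {a b} → ℕ→ℚ (suc n) * a ≡ ℕ→ℚ (suc n) * b → a ≡ b
suc-*-cancelˡ n {a} {b} eq = begin
  a                               ≡⟨ *-identityˡ a ⟨
  1ℚ * a                          ≡⟨ cong (_* a) (trans (*-comm (inv-suc n) (ℕ→ℚ (suc n))) (suc-*-inv-suc n)) ⟨
  inv-suc n * ℕ→ℚ (suc n) * a     ≡⟨ *-assoc (inv-suc n) _ a ⟩
  inv-suc n * (ℕ→ℚ (suc n) * a)   ≡⟨ cong (inv-suc n *_) eq ⟩
  inv-suc n * (ℕ→ℚ (suc n) * b)   ≡⟨ *-assoc (inv-suc n) _ b ⟨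
  inv-suc n * ℕ→ℚ (suc n) * b     ≡⟨ cong (_* b) (trans (*-comm (inv-suc n) (ℕ→ℚ (suc n))) (suc-*-inv-suc n)) ⟩
  1ℚ * b                          ≡⟨ *-identityˡ b ⟩
  b                               ∎

inv-fact-suc : ∀ n → ℕ→ℚ (suc n) * inv-fact (suc n) ≡ inv-fact n
inv-fact-suc n = *-inverse-unique (ℕ→ℚ (n !)) _ _ n!-times (!-*-inv-fact n)
  where
  reassoc : ∀ a b c → a * (b * c) ≡ (b * a) * c
  reassoc = solve-∀ ℚ-ring
  n!-times : ℕ→ℚ (n !) * (ℕ→ℚ (suc n) * inv-fact (suc n)) ≡ 1ℚ
  n!-times = begin
    ℕ→ℚ (n !) * (ℕ→ℚ (suc n) * inv-fact (suc n))  ≡⟨ reassoc (ℕ→ℚ (n !)) (ℕ→ℚ (suc n)) _ ⟩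
    ℕ→ℚ (suc n) * ℕ→ℚ (n !) * inv-fact (suc n)    ≡⟨ cong (_* inv-fact (suc n)) (ℕ→ℚ-* (suc n) (n !)) ⟨
    ℕ→ℚ (suc n !) * inv-fact (suc n)               ≡⟨ !-*-inv-fact (suc n) ⟩
    1ℚ                                             ∎

sumTo-cong-≤ : ∀ n {f g : ℕ → ℚ} → (∀ i → i ≤ n → f i ≡ g i) → sumTo n f ≡ sumTo n g
sumTo-cong-≤ zero    f≡g = f≡g 0 z≤n
sumTo-cong-≤ (suc n) f≡g =
  cong₂ _+_ (sumTo-cong-≤ n (λ i i≤n → f≡g i (ℕ.m≤n⇒m≤1+n i≤n))) (f≡g (suc n) ℕ.≤-refl)

sumTo-cong : ∀ n {f g : ℕ → ℚ} → f ≗ g → sumTo n f ≡ sumTo n g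
sumTo-cong n f≗g = sumTo-cong-≤ n (λ i _ → f≗g i)

sumTo-zero : ∀ n {f : ℕ → ℚ} → (∀ i → i ≤ n → f i ≡ 0ℚ) → sumTo n f ≡ 0ℚ
sumTo-zero zero    f≡0 = f≡0 0 z≤n
sumTo-zero (suc n) f≡0 =
  cong₂ _+_ (sumTo-zero n (λ i i≤n → f≡0 i (ℕ.m≤n⇒m≤1+n i≤n))) (f≡0 (suc n) ℕ.≤-refl)

sumTo-+ : ∀ n (f g : ℕ → ℚ) → sumTo n (λ i → f i + g i) ≡ sumTo n f + sumTo n g
sumTo-+ zero    f g = refl
sumTo-+ (suc n) f g =
  trans (cong (_+ (f (suc n) + g (suc n))) (sumTo-+ n f g)) (interchange (sumTo n f) (sumTo n g) (f (suc n)) (g (suc n)))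
  where
  interchange : ∀ a b c d → (a + b) + (c + d) ≡ (a + c) + (b + d)
  interchange = solve-∀ ℚ-ring

sumTo-*ˡ : ∀ n c (f : ℕ → ℚ) → c * sumTo n f ≡ sumTo n (λ i → c * f i)
sumTo-*ˡ zero    c f = refl
sumTo-*ˡ (suc n) c f = trans (*-distribˡ-+ c (sumTo n f) (f (suc n))) (cong (_+ c * f (suc n)) (sumTo-*ˡ n c f))

sumTo-*ʳ : ∀ n c (f : ℕ → ℚ) → sumTo n f * c ≡ sumTo n (λ i → f i * c)
sumTo-*ʳ zero    c f = refl
sumTo-*ʳ (suc n) c f = trans (*-distribʳ-+ c (sumTo n f) (f (suc n))) (cong (_+ f (suc n) * c) (sumTo-*ʳ n c f))

sumTo-shift : ∀ n (f : ℕ → ℚ) → sumTo (suc n) f ≡ f 0 + sumTo n (λ i → f (suc i))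
sumTo-shift zero    f = refl
sumTo-shift (suc n) f =
  trans (cong (_+ f (suc (suc n))) (sumTo-shift n f)) (+-assoc (f 0) (sumTo n (λ i → f (suc i))) _)

sumTo-extend : ∀ {n} m (f : ℕ → ℚ) → n ≤ m → (∀ i → n < i → f i ≡ 0ℚ) → sumTo m f ≡ sumTo n f
sumTo-extend zero    f z≤n _ = refl
sumTo-extend (suc m) f n≤1+m f≡0 with ℕ.m≤n⇒m<n∨m≡n n≤1+m
... | inj₂ refl        = refl
... | inj₁ (s≤s n≤m) =
  trans (cong₂ _+_ (sumTo-extend m f n≤m f≡0) (f≡0 (suc m) (s≤s n≤m))) (+-identityʳ _)

sumTo-reverse : ∀ n (f : ℕ → ℚ) → sumTo n f ≡ sumTo n (λ i → f (n ∸ i))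
sumTo-reverse zero    f = refl
sumTo-reverse (suc n) f = begin
  sumTo (suc n) f                         ≡⟨ sumTo-shift n f ⟩
  f 0 + sumTo n (λ i → f (suc i))         ≡⟨ cong (f 0 +_) (sumTo-reverse n (λ i → f (suc i))) ⟩
  f 0 + sumTo n (λ i → f (suc (n ∸ i)))   ≡⟨ +-comm (f 0) _ ⟩
  sumTo n (λ i → f (suc (n ∸ i))) + f 0   ≡⟨ cong₂ _+_ (sumTo-cong-≤ n (λ i i≤n → cong f (sym (ℕ.+-∸-assoc 1 i≤n))))
                                                       (cong f (sym (ℕ.n∸n≡0 n))) ⟩
  sumTo (suc n) (λ i → f (suc n ∸ i))     ∎

sumTo-swap : ∀ n m (F : ℕ → ℕ → ℚ) →
             sumTo n (λ i → sumTo m (F i)) ≡ sumTo m (λ j → sumTo n (λ i → F i j))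
sumTo-swap zero    m F = refl
sumTo-swap (suc n) m F = trans (cong (_+ sumTo m (F (suc n))) (sumTo-swap n m F)) (sym (sumTo-+ m _ _))

sumTo-triangle : ∀ n (F : ℕ → ℕ → ℚ) →
                 sumTo n (λ i → sumTo i (F i)) ≡ sumTo n (λ j → sumTo (n ∸ j) (λ k → F (j ℕ.+ k) j))
sumTo-triangle zero    F = refl
sumTo-triangle (suc n) F = begin
  sumTo n (λ i → sumTo i (F i)) + (sumTo n (F (suc n)) + F (suc n) (suc n))
    ≡⟨ cong (_+ (sumTo n (F (suc n)) + F (suc n) (suc n))) (sumTo-triangle n F) ⟩
  R n + (sumTo n (F (suc n)) + F (suc n) (suc n))
    ≡⟨ +-assoc (R n) _ _ ⟨
  (R n + sumTo n (F (suc n))) + F (suc n) (suc n)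
    ≡⟨ cong₂ _+_ (sym (sumTo-+ n _ _)) (cong (λ m → F m (suc n)) (sym (ℕ.+-identityʳ (suc n)))) ⟩
  sumTo n (λ j → sumTo (n ∸ j) (λ k → F (j ℕ.+ k) j) + F (suc n) j) + F (suc n ℕ.+ 0) (suc n)
    ≡⟨ cong₂ _+_ (sumTo-cong-≤ n column) (cong (λ m → sumTo m (λ k → F (suc n ℕ.+ k) (suc n))) (sym (ℕ.n∸n≡0 n))) ⟩
  R (suc n) ∎
  where
  R : ℕ → ℚ
  R n = sumTo n (λ j → sumTo (n ∸ j) (λ k → F (j ℕ.+ k) j))
  column : ∀ j → j ≤ n →
           sumTo (n ∸ j) (λ k → F (j ℕ.+ k) j) + F (suc n) j ≡ sumTo (suc n ∸ j) (λ k → F (j ℕ.+ k) j)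
  column j j≤n rewrite ℕ.+-∸-assoc 1 j≤n =
    cong (λ m → sumTo (n ∸ j) (λ k → F (j ℕ.+ k) j) + F m j)
         (sym (trans (ℕ.+-suc j (n ∸ j)) (cong suc (ℕ.m+[n∸m]≡n j≤n))))

sumTo-pascal : ∀ k (a : ℕ → ℚ) →
               sumTo (suc k) (λ j → ℕ→ℚ (suc k C j) * a j)
               ≡ sumTo k (λ j → ℕ→ℚ (k C j) * a j) + sumTo k (λ j → ℕ→ℚ (k C j) * a (suc j))
sumTo-pascal k a = begin
  sumTo (suc k) (λ j → ℕ→ℚ (suc k C j) * a j)
    ≡⟨ sumTo-shift k _ ⟩
  1ℚ * a 0 + sumTo k (λ j → ℕ→ℚ (suc k C suc j) * a (suc j))
    ≡⟨ cong (1ℚ * a 0 +_) (trans (sumTo-cong k pascal) (sumTo-+ k _ _)) ⟩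
  1ℚ * a 0 + (Shifted + Rest)
    ≡⟨ rearrange (1ℚ * a 0) Shifted Rest ⟩
  (1ℚ * a 0 + Rest) + Shifted
    ≡⟨ cong (_+ Shifted) (sym (sumTo-shift k (λ j → ℕ→ℚ (k C j) * a j))) ⟩
  (sumTo k (λ j → ℕ→ℚ (k C j) * a j) + ℕ→ℚ (k C suc k) * a (suc k)) + Shifted
    ≡⟨ cong (λ c → (sumTo k (λ j → ℕ→ℚ (k C j) * a j) + ℕ→ℚ c * a (suc k)) + Shifted) (k>n⇒nCk≡0 (ℕ.n<1+n k)) ⟩
  (sumTo k (λ j → ℕ→ℚ (k C j) * a j) + 0ℚ * a (suc k)) + Shifted
    ≡⟨ cong (_+ Shifted) (trans (cong (sumTo k (λ j → ℕ→ℚ (k C j) * a j) +_) (*-zeroˡ (a (suc k)))) (+-identityʳ (sumTo k (λ j → ℕ→ℚ (k C j) * a j)))) ⟩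
  sumTo k (λ j → ℕ→ℚ (k C j) * a j) + Shifted ∎
  where
  Shifted = sumTo k (λ j → ℕ→ℚ (k C j) * a (suc j))
  Rest    = sumTo k (λ j → ℕ→ℚ (k C suc j) * a (suc j))
  pascal : ∀ j → ℕ→ℚ (suc k C suc j) * a (suc j) ≡ ℕ→ℚ (k C j) * a (suc j) + ℕ→ℚ (k C suc j) * a (suc j)
  pascal j = begin
    ℕ→ℚ (suc k C suc j) * a (suc j)                  ≡⟨ cong (λ c → ℕ→ℚ c * a (suc j)) (nCk+nC[k+1]≡[n+1]C[k+1] k j) ⟨
    ℕ→ℚ (k C j ℕ.+ k C suc j) * a (suc j)            ≡⟨ cong (_* a (suc j)) (ℕ→ℚ-+ (k C j) (k C suc j)) ⟩
    (ℕ→ℚ (k C j) + ℕ→ℚ (k C suc j)) * a (suc j)      ≡⟨ *-distribʳ-+ (a (suc j)) (ℕ→ℚ (k C j)) (ℕ→ℚ (k C suc j)) ⟩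
    ℕ→ℚ (k C j) * a (suc j) + ℕ→ℚ (k C suc j) * a (suc j) ∎
  rearrange : ∀ x s r → x + (s + r) ≡ (x + r) + s
  rearrange = solve-∀ ℚ-ring

-- Formal power series

1ˢ : Series
1ˢ zero    = 1ℚ
1ˢ (suc n) = 0ℚ

infixl 6 _+ˢ_
infixr 7 _·ˢ_
infixr 21 X·_

_+ˢ_ : Series → Series → Series
(f +ˢ g) n = f n + g n

_·ˢ_ : ℚ → Series → Series
(c ·ˢ f) n = c * f n

X·_ : Series → Series
(X· f) zero    = 0ℚ
(X· f) (suc n) = f n

linComb : ℕ → (ℕ → ℚ) → (ℕ → Series) → Series
linComb k c F n = sumTo k (λ j → c j * F j n)

⊛-cong : ∀ {f f′ g g′} → f ≗ f′ → g ≗ g′ → (f ⊛ g) ≗ (f′ ⊛ g′)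
⊛-cong f≗f′ g≗g′ n = sumTo-cong n (λ i → cong₂ _*_ (f≗f′ i) (g≗g′ (n ∸ i)))

⊛-congˡ : ∀ {f f′} g → f ≗ f′ → (f ⊛ g) ≗ (f′ ⊛ g)
⊛-congˡ g f≗f′ = ⊛-cong {g = g} f≗f′ (λ _ → refl)

⊛-congʳ : ∀ f {g g′} → g ≗ g′ → (f ⊛ g) ≗ (f ⊛ g′)
⊛-congʳ f g≗g′ = ⊛-cong {f} {f} (λ _ → refl) g≗g′

⊛-comm : ∀ f g → (f ⊛ g) ≗ (g ⊛ f)
⊛-comm f g n = trans (sumTo-reverse n (λ i → f i * g (n ∸ i))) (sumTo-cong-≤ n swap)
  where
  swap : ∀ i → i ≤ n → f (n ∸ i) * g (n ∸ (n ∸ i)) ≡ g i * f (n ∸ i)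
  swap i i≤n = trans (cong (λ j → f (n ∸ i) * g j) (ℕ.m∸[m∸n]≡n i≤n)) (*-comm (f (n ∸ i)) (g i))

⊛-identityˡ : ∀ f → (1ˢ ⊛ f) ≗ f
⊛-identityˡ f zero    = *-identityˡ (f 0)
⊛-identityˡ f (suc n) = begin
  sumTo (suc n) (λ i → 1ˢ i * f (suc n ∸ i))        ≡⟨ sumTo-shift n _ ⟩
  1ℚ * f (suc n) + sumTo n (λ i → 0ℚ * f (n ∸ i))   ≡⟨ cong₂ _+_ (*-identityˡ (f (suc n)))
                                                                  (sumTo-zero n (λ i _ → *-zeroˡ (f (n ∸ i)))) ⟩
  f (suc n) + 0ℚ                                     ≡⟨ +-identityʳ (f (suc n)) ⟩
  f (suc n)                                          ∎

⊛-identityʳ : ∀ f → (f ⊛ 1ˢ) ≗ f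
⊛-identityʳ f n = trans (⊛-comm f 1ˢ n) (⊛-identityˡ f n)

⊛-assoc : ∀ f g h → ((f ⊛ g) ⊛ h) ≗ (f ⊛ (g ⊛ h))
⊛-assoc f g h n = begin
  sumTo n (λ i → sumTo i (λ j → f j * g (i ∸ j)) * h (n ∸ i))
    ≡⟨ sumTo-cong n (λ i → sumTo-*ʳ i (h (n ∸ i)) (λ j → f j * g (i ∸ j))) ⟩
  sumTo n (λ i → sumTo i (λ j → f j * g (i ∸ j) * h (n ∸ i)))
    ≡⟨ sumTo-triangle n (λ i j → f j * g (i ∸ j) * h (n ∸ i)) ⟩
  sumTo n (λ j → sumTo (n ∸ j) (λ m → f j * g (j ℕ.+ m ∸ j) * h (n ∸ (j ℕ.+ m))))
    ≡⟨ sumTo-cong n (λ j → sumTo-cong (n ∸ j) (reindex j)) ⟩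
  sumTo n (λ j → sumTo (n ∸ j) (λ m → f j * (g m * h (n ∸ j ∸ m))))
    ≡⟨ sumTo-cong n (λ j → sumTo-*ˡ (n ∸ j) (f j) (λ m → g m * h (n ∸ j ∸ m))) ⟨
  sumTo n (λ j → f j * sumTo (n ∸ j) (λ m → g m * h (n ∸ j ∸ m))) ∎
  where
  reindex : ∀ j m → f j * g (j ℕ.+ m ∸ j) * h (n ∸ (j ℕ.+ m)) ≡ f j * (g m * h (n ∸ j ∸ m))
  reindex j m = trans (cong₂ (λ a b → f j * g a * h b) (ℕ.m+n∸m≡n j m) (sym (ℕ.∸-+-assoc n j m)))
                      (*-assoc (f j) (g m) (h (n ∸ j ∸ m)))

⊛-distribˡ-+ˢ : ∀ f g h → (f ⊛ (g +ˢ h)) ≗ (f ⊛ g) +ˢ (f ⊛ h)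
⊛-distribˡ-+ˢ f g h n =
  trans (sumTo-cong n (λ i → *-distribˡ-+ (f i) (g (n ∸ i)) (h (n ∸ i))))
        (sumTo-+ n (λ i → f i * g (n ∸ i)) (λ i → f i * h (n ∸ i)))

⊛-·ˢˡ : ∀ c f g → ((c ·ˢ f) ⊛ g) ≗ c ·ˢ (f ⊛ g)
⊛-·ˢˡ c f g n = trans (sumTo-cong n (λ i → *-assoc c (f i) (g (n ∸ i)))) (sym (sumTo-*ˡ n c (λ i → f i * g (n ∸ i))))

⊛-X·ʳ : ∀ f g → (f ⊛ X· g) ≗ X· (f ⊛ g)
⊛-X·ʳ f g zero    = *-zeroʳ (f 0)
⊛-X·ʳ f g (suc n) = begin
  sumTo n (λ i → f i * (X· g) (suc n ∸ i)) + f (suc n) * (X· g) (suc n ∸ suc n)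
    ≡⟨ cong₂ _+_ (sumTo-cong-≤ n (λ i i≤n → cong (λ m → f i * (X· g) m) (ℕ.+-∸-assoc 1 i≤n)))
                 (cong (λ m → f (suc n) * (X· g) m) (ℕ.n∸n≡0 (suc n))) ⟩
  (f ⊛ g) n + f (suc n) * 0ℚ
    ≡⟨ trans (cong ((f ⊛ g) n +_) (*-zeroʳ (f (suc n)))) (+-identityʳ ((f ⊛ g) n)) ⟩
  (f ⊛ g) n ∎

⊛-linCombˡ : ∀ k c F g → (linComb k c F ⊛ g) ≗ linComb k c (λ j → F j ⊛ g)
⊛-linCombˡ k c F g n = begin
  sumTo n (λ i → sumTo k (λ j → c j * F j i) * g (n ∸ i))
    ≡⟨ sumTo-cong n (λ i → sumTo-*ʳ k (g (n ∸ i)) (λ j → c j * F j i)) ⟩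
  sumTo n (λ i → sumTo k (λ j → c j * F j i * g (n ∸ i)))
    ≡⟨ sumTo-swap n k (λ i j → c j * F j i * g (n ∸ i)) ⟩
  sumTo k (λ j → sumTo n (λ i → c j * F j i * g (n ∸ i)))
    ≡⟨ sumTo-cong k (λ j → ⊛-·ˢˡ (c j) (F j) g n) ⟩
  linComb k c (λ j → F j ⊛ g) n ∎

⊛-distribʳ-+ˢ : ∀ f g h → ((f +ˢ g) ⊛ h) ≗ (f ⊛ h) +ˢ (g ⊛ h)
⊛-distribʳ-+ˢ f g h n = begin
  ((f +ˢ g) ⊛ h) n          ≡⟨ ⊛-comm (f +ˢ g) h n ⟩
  (h ⊛ (f +ˢ g)) n          ≡⟨ ⊛-distribˡ-+ˢ h f g n ⟩
  (h ⊛ f) n + (h ⊛ g) n     ≡⟨ cong₂ _+_ (⊛-comm h f n) (⊛-comm h g n) ⟩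
  (f ⊛ h) n + (g ⊛ h) n     ∎

⊛-·ˢʳ : ∀ c f g → (f ⊛ (c ·ˢ g)) ≗ c ·ˢ (f ⊛ g)
⊛-·ˢʳ c f g n = trans (⊛-comm f (c ·ˢ g) n) (trans (⊛-·ˢˡ c g f n) (cong (c *_) (⊛-comm g f n)))

⊛-X·ˡ : ∀ f g → ((X· f) ⊛ g) ≗ X· (f ⊛ g)
⊛-X·ˡ f g zero    = trans (⊛-comm (X· f) g 0) (⊛-X·ʳ g f 0)
⊛-X·ˡ f g (suc n) = trans (⊛-comm (X· f) g (suc n)) (trans (⊛-X·ʳ g f (suc n)) (⊛-comm g f n))

X·-tail : ∀ f → f 0 ≡ 0ℚ → f ≗ X· (λ n → f (suc n))
X·-tail f f0≡0 zero    = f0≡0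
X·-tail f f0≡0 (suc n) = refl

pow-zero : ∀ f → pow f 0 ≗ 1ˢ
pow-zero f zero    = refl
pow-zero f (suc n) = refl

pow-⊛-1ˢ+ : ∀ e u → e ≗ 1ˢ +ˢ u → ∀ k → (pow u k ⊛ e) ≗ pow u k +ˢ pow u (suc k)
pow-⊛-1ˢ+ e u e≗1+u k n = begin
  (pow u k ⊛ e) n                          ≡⟨ ⊛-congʳ (pow u k) e≗1+u n ⟩
  (pow u k ⊛ (1ˢ +ˢ u)) n                  ≡⟨ ⊛-distribˡ-+ˢ (pow u k) 1ˢ u n ⟩
  (pow u k ⊛ 1ˢ) n + pow u (suc k) n       ≡⟨ cong (_+ pow u (suc k) n) (⊛-identityʳ (pow u k) n) ⟩
  pow u k n + pow u (suc k) n              ∎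

binomial : ∀ e u → e ≗ 1ˢ +ˢ u → ∀ k → linComb k (λ j → ℕ→ℚ (k C j) * sgn j) (pow e) ≗ sgn k ·ˢ pow u k
binomial e u e≗1+u zero    n = cong (1ℚ *_) (trans (pow-zero e n) (sym (pow-zero u n)))
binomial e u e≗1+u (suc k) n = begin
  sumTo (suc k) (λ j → ℕ→ℚ (suc k C j) * sgn j * pow e j n)
    ≡⟨ sumTo-cong (suc k) (λ j → *-assoc (ℕ→ℚ (suc k C j)) (sgn j) (pow e j n)) ⟩
  sumTo (suc k) (λ j → ℕ→ℚ (suc k C j) * (sgn j * pow e j n))
    ≡⟨ sumTo-pascal k (λ j → sgn j * pow e j n) ⟩
  sumTo k (λ j → ℕ→ℚ (k C j) * (sgn j * pow e j n))
    + sumTo k (λ j → ℕ→ℚ (k C j) * (sgn j * - 1ℚ * pow e (suc j) n))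
    ≡⟨ cong₂ _+_ (sumTo-cong k (λ j → sym (*-assoc (ℕ→ℚ (k C j)) (sgn j) (pow e j n))))
                 (sumTo-cong k (λ j → pull-sign (ℕ→ℚ (k C j)) (sgn j) (pow e (suc j) n))) ⟩
  B n + sumTo k (λ j → - 1ℚ * (ℕ→ℚ (k C j) * sgn j * (pow e j ⊛ e) n))
    ≡⟨ cong (B n +_) (sumTo-*ˡ k (- 1ℚ) (λ j → ℕ→ℚ (k C j) * sgn j * (pow e j ⊛ e) n)) ⟨
  B n + - 1ℚ * linComb k (λ j → ℕ→ℚ (k C j) * sgn j) (λ j → pow e j ⊛ e) n
    ≡⟨ cong (λ z → B n + - 1ℚ * z) (⊛-linCombˡ k (λ j → ℕ→ℚ (k C j) * sgn j) (pow e) e n) ⟨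
  B n + - 1ℚ * (B ⊛ e) n
    ≡⟨ cong₂ (λ a b → a + - 1ℚ * b) (binomial e u e≗1+u k n)
             (trans (⊛-congˡ e (binomial e u e≗1+u k) n) (⊛-·ˢˡ (sgn k) (pow u k) e n)) ⟩
  sgn k * pow u k n + - 1ℚ * (sgn k * (pow u k ⊛ e) n)
    ≡⟨ cong (λ z → sgn k * pow u k n + - 1ℚ * (sgn k * z)) (pow-⊛-1ˢ+ e u e≗1+u k n) ⟩
  sgn k * pow u k n + - 1ℚ * (sgn k * (pow u k n + pow u (suc k) n))
    ≡⟨ telescope (sgn k) (pow u k n) (pow u (suc k) n) ⟩
  sgn (suc k) * pow u (suc k) n ∎
  where
  B = linComb k (λ j → ℕ→ℚ (k C j) * sgn j) (pow e)
  pull-sign : ∀ c s y → c * (s * - 1ℚ * y) ≡ - 1ℚ * (c * s * y)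
  pull-sign = solve-∀ ℚ-ring
  telescope : ∀ s p q → s * p + - 1ℚ * (s * (p + q)) ≡ s * - 1ℚ * q
  telescope = solve-∀ ℚ-ring

-- The derivation (1 + λt) d/dt

∂ : Series → Series
∂ f n = ℕ→ℚ (suc n) * f (suc n)

euler : Series → Series
euler f n = ℕ→ℚ n * f n

-- euler f is t f′, so Dλ λ' f = f′ + λ' t f′.
Dλ : ℚ → Series → Series
Dλ λ' f n = ∂ f n + λ' * euler f n

euler-leibniz : ∀ f g → euler (f ⊛ g) ≗ (euler f ⊛ g) +ˢ (f ⊛ euler g)
euler-leibniz f g n =
  trans (sumTo-*ˡ n (ℕ→ℚ n) (λ i → f i * g (n ∸ i)))
        (trans (sumTo-cong-≤ n split) (sumTo-+ n (λ i → euler f i * g (n ∸ i)) (λ i → f i * euler g (n ∸ i))))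
  where
  distrib : ∀ a b x y → (a + b) * (x * y) ≡ a * x * y + x * (b * y)
  distrib = solve-∀ ℚ-ring
  split : ∀ i → i ≤ n → ℕ→ℚ n * (f i * g (n ∸ i)) ≡ euler f i * g (n ∸ i) + f i * euler g (n ∸ i)
  split i i≤n = begin
    ℕ→ℚ n * (f i * g (n ∸ i))
      ≡⟨ cong (λ m → ℕ→ℚ m * (f i * g (n ∸ i))) (ℕ.m+[n∸m]≡n i≤n) ⟨
    ℕ→ℚ (i ℕ.+ (n ∸ i)) * (f i * g (n ∸ i))
      ≡⟨ cong (_* (f i * g (n ∸ i))) (ℕ→ℚ-+ i (n ∸ i)) ⟩
    (ℕ→ℚ i + ℕ→ℚ (n ∸ i)) * (f i * g (n ∸ i))
      ≡⟨ distrib (ℕ→ℚ i) (ℕ→ℚ (n ∸ i)) (f i) (g (n ∸ i)) ⟩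
    euler f i * g (n ∸ i) + f i * euler g (n ∸ i) ∎

Dλ-cong : ∀ λ' {f g} → f ≗ g → Dλ λ' f ≗ Dλ λ' g
Dλ-cong λ' f≗g n = cong₂ (λ a b → ℕ→ℚ (suc n) * a + λ' * (ℕ→ℚ n * b)) (f≗g (suc n)) (f≗g n)

⊛-Dλˡ : ∀ λ' f g n → (Dλ λ' f ⊛ g) n ≡ (euler f ⊛ g) (suc n) + λ' * (euler f ⊛ g) n
⊛-Dλˡ λ' f g n = begin
  (Dλ λ' f ⊛ g) n
    ≡⟨ ⊛-distribʳ-+ˢ (∂ f) (λ' ·ˢ euler f) g n ⟩
  (∂ f ⊛ g) n + ((λ' ·ˢ euler f) ⊛ g) n
    ≡⟨ cong₂ _+_ (sym (⊛-X·ˡ (∂ f) g (suc n))) (⊛-·ˢˡ λ' (euler f) g n) ⟩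
  ((X· ∂ f) ⊛ g) (suc n) + λ' * (euler f ⊛ g) n
    ≡⟨ cong (_+ λ' * (euler f ⊛ g) n) (⊛-congˡ g (λ m → sym (X·-tail (euler f) (*-zeroˡ (f 0)) m)) (suc n)) ⟩
  (euler f ⊛ g) (suc n) + λ' * (euler f ⊛ g) n ∎

Dλ-leibniz : ∀ λ' f g → Dλ λ' (f ⊛ g) ≗ (Dλ λ' f ⊛ g) +ˢ (f ⊛ Dλ λ' g)
Dλ-leibniz λ' f g n = begin
  Dλ λ' (f ⊛ g) n
    ≡⟨ cong₂ (λ a b → a + λ' * b) (euler-leibniz f g (suc n)) (euler-leibniz f g n) ⟩
  (A (suc n) + B (suc n)) + λ' * (A n + B n)
    ≡⟨ cong₂ (λ a b → (A (suc n) + a) + λ' * (A n + b)) (⊛-comm f (euler g) (suc n)) (⊛-comm f (euler g) n) ⟩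
  (A (suc n) + B′ (suc n)) + λ' * (A n + B′ n)
    ≡⟨ regroup (A (suc n)) (B′ (suc n)) λ' (A n) (B′ n) ⟩
  (A (suc n) + λ' * A n) + (B′ (suc n) + λ' * B′ n)
    ≡⟨ cong₂ _+_ (⊛-Dλˡ λ' f g n) (⊛-Dλˡ λ' g f n) ⟨
  (Dλ λ' f ⊛ g) n + (Dλ λ' g ⊛ f) n
    ≡⟨ cong ((Dλ λ' f ⊛ g) n +_) (⊛-comm (Dλ λ' g) f n) ⟩
  (Dλ λ' f ⊛ g) n + (f ⊛ Dλ λ' g) n ∎
  where
  A B B′ : Series
  A  = euler f ⊛ g
  B  = f ⊛ euler g
  B′ = euler g ⊛ f
  regroup : ∀ a b l c d → (a + b) + l * (c + d) ≡ (a + l * c) + (b + l * d)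
  regroup = solve-∀ ℚ-ring

Dλ-linComb : ∀ λ' k c F → Dλ λ' (linComb k c F) ≗ linComb k c (λ j → Dλ λ' (F j))
Dλ-linComb λ' k c F n = begin
  ℕ→ℚ (suc n) * sumTo k (λ j → c j * F j (suc n)) + λ' * (ℕ→ℚ n * sumTo k (λ j → c j * F j n))
    ≡⟨ cong₂ (λ a b → a + λ' * b) (sumTo-*ˡ k (ℕ→ℚ (suc n)) _) (sumTo-*ˡ k (ℕ→ℚ n) _) ⟩
  sumTo k (λ j → ℕ→ℚ (suc n) * (c j * F j (suc n))) + λ' * sumTo k (λ j → ℕ→ℚ n * (c j * F j n))
    ≡⟨ cong (sumTo k (λ j → ℕ→ℚ (suc n) * (c j * F j (suc n))) +_) (sumTo-*ˡ k λ' _) ⟩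
  sumTo k (λ j → ℕ→ℚ (suc n) * (c j * F j (suc n))) + sumTo k (λ j → λ' * (ℕ→ℚ n * (c j * F j n)))
    ≡⟨ sumTo-+ k _ _ ⟨
  sumTo k (λ j → ℕ→ℚ (suc n) * (c j * F j (suc n)) + λ' * (ℕ→ℚ n * (c j * F j n)))
    ≡⟨ sumTo-cong k (λ j → factor (ℕ→ℚ (suc n)) (c j) (F j (suc n)) λ' (ℕ→ℚ n) (F j n)) ⟩
  linComb k c (λ j → Dλ λ' (F j)) n ∎
  where
  factor : ∀ s a x l m y → s * (a * x) + l * (m * (a * y)) ≡ a * (s * x + l * (m * y))
  factor = solve-∀ ℚ-ring

Dλ-1ˢ : ∀ λ' n → Dλ λ' 1ˢ n ≡ 0ℚ
Dλ-1ˢ λ' zero    = vanish (ℕ→ℚ 1) λ'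
  where
  vanish : ∀ a l → a * 0ℚ + l * (0ℚ * 1ℚ) ≡ 0ℚ
  vanish = solve-∀ ℚ-ring
Dλ-1ˢ λ' (suc n) = vanish (ℕ→ℚ (suc (suc n))) λ' (ℕ→ℚ (suc n))
  where
  vanish : ∀ a l b → a * 0ℚ + l * (b * 0ℚ) ≡ 0ℚ
  vanish = solve-∀ ℚ-ring

Dλ-pow : ∀ λ' f k → Dλ λ' (pow f (suc k)) ≗ ℕ→ℚ (suc k) ·ˢ (pow f k ⊛ Dλ λ' f)
Dλ-pow λ' f zero n = begin
  Dλ λ' (pow f 0 ⊛ f) n
    ≡⟨ Dλ-leibniz λ' (pow f 0) f n ⟩
  (Dλ λ' (pow f 0) ⊛ f) n + (pow f 0 ⊛ Dλ λ' f) n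
    ≡⟨ cong (_+ (pow f 0 ⊛ Dλ λ' f) n) (sumTo-zero n constant-term) ⟩
  0ℚ + (pow f 0 ⊛ Dλ λ' f) n
    ≡⟨ unit ((pow f 0 ⊛ Dλ λ' f) n) ⟩
  1ℚ * (pow f 0 ⊛ Dλ λ' f) n ∎
  where
  constant-term : ∀ i → i ≤ n → Dλ λ' (pow f 0) i * f (n ∸ i) ≡ 0ℚ
  constant-term i _ = trans (cong (_* f (n ∸ i)) (trans (Dλ-cong λ' (pow-zero f) i) (Dλ-1ˢ λ' i))) (*-zeroˡ (f (n ∸ i)))
  unit : ∀ x → 0ℚ + x ≡ 1ℚ * x
  unit = solve-∀ ℚ-ring
Dλ-pow λ' f (suc k) n = begin
  Dλ λ' (pow f (suc k) ⊛ f) n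
    ≡⟨ Dλ-leibniz λ' (pow f (suc k)) f n ⟩
  (Dλ λ' (pow f (suc k)) ⊛ f) n + X
    ≡⟨ cong (_+ X) (trans (⊛-congˡ f (Dλ-pow λ' f k) n) (⊛-·ˢˡ (ℕ→ℚ (suc k)) (pow f k ⊛ Df) f n)) ⟩
  ℕ→ℚ (suc k) * ((pow f k ⊛ Df) ⊛ f) n + X
    ≡⟨ cong (λ z → ℕ→ℚ (suc k) * z + X) move-f ⟩
  ℕ→ℚ (suc k) * X + X
    ≡⟨ collect (ℕ→ℚ (suc k)) X ⟩
  (ℕ→ℚ (suc k) + 1ℚ) * X
    ≡⟨ cong (_* X) (ℕ→ℚ-suc (suc k)) ⟨
  ℕ→ℚ (suc (suc k)) * X ∎
  where
  Df = Dλ λ' f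
  X = (pow f (suc k) ⊛ Df) n
  move-f : ((pow f k ⊛ Df) ⊛ f) n ≡ X
  move-f = begin
    ((pow f k ⊛ Df) ⊛ f) n   ≡⟨ ⊛-assoc (pow f k) Df f n ⟩
    (pow f k ⊛ (Df ⊛ f)) n   ≡⟨ ⊛-congʳ (pow f k) (⊛-comm Df f) n ⟩
    (pow f k ⊛ (f ⊛ Df)) n   ≡⟨ ⊛-assoc (pow f k) f Df n ⟨
    X                        ∎
  collect : ∀ a x → a * x + x ≡ (a + 1ℚ) * x
  collect = solve-∀ ℚ-ring

ode-uniqueness : ∀ λ' c {F G} → F 0 ≡ G 0 →
                 (∀ n → Dλ λ' F n - c * F n ≡ Dλ λ' G n - c * G n) → F ≗ G
ode-uniqueness λ' c F0≡G0 eq zero    = F0≡G0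
ode-uniqueness λ' c {F} {G} F0≡G0 eq (suc n) = suc-*-cancelˡ n (begin
  ℕ→ℚ (suc n) * F (suc n)                           ≡⟨ isolate (euler F (suc n)) (λ' * euler F n) (c * F n) ⟩
  (Dλ λ' F n - c * F n) - (λ' * euler F n - c * F n) ≡⟨ cong₂ _-_ (eq n) (cong (λ z → λ' * (ℕ→ℚ n * z) - c * z) Fn≡Gn) ⟩
  (Dλ λ' G n - c * G n) - (λ' * euler G n - c * G n) ≡⟨ isolate (euler G (suc n)) (λ' * euler G n) (c * G n) ⟨
  ℕ→ℚ (suc n) * G (suc n)                           ∎)
  where
  Fn≡Gn = ode-uniqueness λ' c F0≡G0 eq n
  isolate : ∀ a b d → a ≡ ((a + b) - d) - (b - d)
  isolate = solve-∀ ℚ-ring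

Dλ-injective : ∀ λ' {F G} → F 0 ≡ G 0 → Dλ λ' F ≗ Dλ λ' G → F ≗ G
Dλ-injective λ' {F} {G} F0≡G0 DF≗DG = ode-uniqueness λ' 0ℚ F0≡G0 (λ n →
  trans (drop (Dλ λ' F n) (F n)) (trans (DF≗DG n) (sym (drop (Dλ λ' G n) (G n)))))
  where
  drop : ∀ a x → a - 0ℚ * x ≡ a
  drop = solve-∀ ℚ-ring

-- The degenerate exponential

n!-*-eλ : ∀ λ' x n → ℕ→ℚ (n !) * eλ λ' x n ≡ dff x λ' n
n!-*-eλ λ' x n = begin
  ℕ→ℚ (n !) * (dff x λ' n * inv-fact n)  ≡⟨ swap (ℕ→ℚ (n !)) (dff x λ' n) (inv-fact n) ⟩
  dff x λ' n * (ℕ→ℚ (n !) * inv-fact n)  ≡⟨ cong (dff x λ' n *_) (!-*-inv-fact n) ⟩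
  dff x λ' n * 1ℚ                         ≡⟨ *-identityʳ (dff x λ' n) ⟩
  dff x λ' n                              ∎
  where
  swap : ∀ a b c → a * (b * c) ≡ b * (a * c)
  swap = solve-∀ ℚ-ring

Dλ-eλ : ∀ λ' x → Dλ λ' (eλ λ' x) ≗ x ·ˢ eλ λ' x
Dλ-eλ λ' x n = begin
  ℕ→ℚ (suc n) * (d * (x - m * λ') * inv-fact (suc n)) + λ' * (m * (d * inv-fact n))
    ≡⟨ cong (_+ λ' * (m * (d * inv-fact n))) (reassoc (ℕ→ℚ (suc n)) d (x - m * λ') (inv-fact (suc n))) ⟩
  d * (x - m * λ') * (ℕ→ℚ (suc n) * inv-fact (suc n)) + λ' * (m * (d * inv-fact n))
    ≡⟨ cong (λ z → d * (x - m * λ') * z + λ' * (m * (d * inv-fact n))) (inv-fact-suc n) ⟩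
  d * (x - m * λ') * inv-fact n + λ' * (m * (d * inv-fact n))
    ≡⟨ cancel d x m λ' (inv-fact n) ⟩
  x * (d * inv-fact n) ∎
  where
  d = dff x λ' n
  m = ℕ→ℚ n
  reassoc : ∀ s a b j → s * (a * b * j) ≡ a * b * (s * j)
  reassoc = solve-∀ ℚ-ring
  cancel : ∀ d x m l i → d * (x - m * l) * i + l * (m * (d * i)) ≡ x * (d * i)
  cancel = solve-∀ ℚ-ring

dff-0 : ∀ λ' n → dff 0ℚ λ' (suc n) ≡ 0ℚ
dff-0 λ' zero    = vanish λ'
  where
  vanish : ∀ l → 1ℚ * (0ℚ - 0ℚ * l) ≡ 0ℚ
  vanish = solve-∀ ℚ-ring
dff-0 λ' (suc n) = trans (cong (_* (0ℚ - ℕ→ℚ (suc n) * λ')) (dff-0 λ' n)) (*-zeroˡ (0ℚ - ℕ→ℚ (suc n) * λ'))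

eλ-0 : ∀ λ' → eλ λ' 0ℚ ≗ 1ˢ
eλ-0 λ' zero    = refl
eλ-0 λ' (suc n) = trans (cong (_* inv-fact (suc n)) (dff-0 λ' n)) (*-zeroˡ (inv-fact (suc n)))

eλ-+ : ∀ λ' x y → eλ λ' (x + y) ≗ (eλ λ' x ⊛ eλ λ' y)
eλ-+ λ' x y = ode-uniqueness λ' (x + y) refl (λ n →
  trans (eigen (eλ λ' (x + y)) (Dλ-eλ λ' (x + y)) n) (sym (eigen (Ex ⊛ Ey) Dλ-product n)))
  where
  Ex = eλ λ' x
  Ey = eλ λ' y
  eigen : ∀ F → Dλ λ' F ≗ (x + y) ·ˢ F → ∀ n → Dλ λ' F n - (x + y) * F n ≡ 0ℚ
  eigen F DF n = trans (cong (_- (x + y) * F n) (DF n)) (+-inverseʳ ((x + y) * F n))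
  Dλ-product : Dλ λ' (Ex ⊛ Ey) ≗ (x + y) ·ˢ (Ex ⊛ Ey)
  Dλ-product n = begin
    Dλ λ' (Ex ⊛ Ey) n
      ≡⟨ Dλ-leibniz λ' Ex Ey n ⟩
    (Dλ λ' Ex ⊛ Ey) n + (Ex ⊛ Dλ λ' Ey) n
      ≡⟨ cong₂ _+_ (trans (⊛-congˡ Ey (Dλ-eλ λ' x) n) (⊛-·ˢˡ x Ex Ey n))
                   (trans (⊛-congʳ Ex (Dλ-eλ λ' y) n) (⊛-·ˢʳ y Ex Ey n)) ⟩
    x * (Ex ⊛ Ey) n + y * (Ex ⊛ Ey) n
      ≡⟨ *-distribʳ-+ ((Ex ⊛ Ey) n) x y ⟨
    (x + y) * (Ex ⊛ Ey) n ∎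

eλ-ℕ : ∀ λ' j → eλ λ' (ℕ→ℚ j) ≗ pow (eλ λ' 1ℚ) j
eλ-ℕ λ' zero    n = trans (eλ-0 λ' n) (sym (pow-zero (eλ λ' 1ℚ) n))
eλ-ℕ λ' (suc j) n = begin
  eλ λ' (ℕ→ℚ (suc j)) n               ≡⟨ cong (λ x → eλ λ' x n) (ℕ→ℚ-suc j) ⟩
  eλ λ' (ℕ→ℚ j + 1ℚ) n                ≡⟨ eλ-+ λ' (ℕ→ℚ j) 1ℚ n ⟩
  (eλ λ' (ℕ→ℚ j) ⊛ eλ λ' 1ℚ) n        ≡⟨ ⊛-congˡ (eλ λ' 1ℚ) (eλ-ℕ λ' j) n ⟩
  (pow (eλ λ' 1ℚ) j ⊛ eλ λ' 1ℚ) n     ∎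

eλ≗1ˢ+eλ-1 : ∀ λ' → eλ λ' 1ℚ ≗ 1ˢ +ˢ eλ-1 λ'
eλ≗1ˢ+eλ-1 λ' zero    = refl
eλ≗1ˢ+eλ-1 λ' (suc n) = sym (+-identityˡ (eλ λ' 1ℚ (suc n)))

Dλ-eλ-1 : ∀ λ' → Dλ λ' (eλ-1 λ') ≗ eλ λ' 1ℚ
Dλ-eλ-1 λ' zero    = trans (cong (λ z → euler (eλ-1 λ') 1 + λ' * z) (*-zeroˡ 1ℚ))
                           (trans (Dλ-eλ λ' 1ℚ 0) (*-identityˡ (eλ λ' 1ℚ 0)))
Dλ-eλ-1 λ' (suc n) = trans (Dλ-eλ λ' 1ℚ (suc n)) (*-identityˡ (eλ λ' 1ℚ (suc n)))

nth-++ˡ : ∀ (xs ys : List ℚ) i → i < length xs → nth (xs ++ ys) i ≡ nth xs i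
nth-++ˡ (x ∷ xs) ys zero    _         = refl
nth-++ˡ (x ∷ xs) ys (suc i) (s≤s i<n) = nth-++ˡ xs ys i i<n

nth-length : ∀ (xs : List ℚ) y → nth (xs ++ y ∷ []) (length xs) ≡ y
nth-length []       y = refl
nth-length (x ∷ xs) y = nth-length xs y

length-invL : ∀ d n → length (invL d n) ≡ suc n
length-invL d zero    = refl
length-invL d (suc n) = trans (length-++ (invL d n)) (trans (cong (ℕ._+ 1) (length-invL d n)) (ℕ.+-comm (suc n) 1))

nth-invL : ∀ d {m} n → m ≤ n → nth (invL d n) m ≡ inv1 d m
nth-invL d zero z≤n = refl
nth-invL d {m} (suc n) m≤1+n with ℕ.m≤n⇒m<n∨m≡n m≤1+n
... | inj₂ refl  = refl
... | inj₁ m<1+n = trans (nth-++ˡ (invL d n) _ m (subst (m <_) (sym (length-invL d n)) m<1+n))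
                         (nth-invL d n (ℕ.≤-pred m<1+n))

inv1-suc : ∀ d n → inv1 d (suc n) ≡ - sumTo n (λ i → d (suc i) * inv1 d (n ∸ i))
inv1-suc d n = begin
  nth (invL d n ++ last ∷ []) (suc n)       ≡⟨ cong (nth (invL d n ++ last ∷ [])) (length-invL d n) ⟨
  nth (invL d n ++ last ∷ []) (length (invL d n)) ≡⟨ nth-length (invL d n) last ⟩
  last                                       ≡⟨ cong -_ (sumTo-cong-≤ n (λ i i≤n → cong (d (suc i) *_) (nth-invL d n (ℕ.m∸n≤m n i)))) ⟩
  - sumTo n (λ i → d (suc i) * inv1 d (n ∸ i)) ∎
  where
  last = - sumTo n (λ i → d (suc i) * nth (invL d n) (n ∸ i))

⊛-inv1 : ∀ d → d 0 ≡ 1ℚ → (d ⊛ inv1 d) ≗ 1ˢ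
⊛-inv1 d d0≡1 zero    = cong (_* 1ℚ) d0≡1
⊛-inv1 d d0≡1 (suc n) = begin
  (d ⊛ inv1 d) (suc n)
    ≡⟨ sumTo-shift n (λ i → d i * inv1 d (suc n ∸ i)) ⟩
  d 0 * inv1 d (suc n) + sumTo n (λ i → d (suc i) * inv1 d (n ∸ i))
    ≡⟨ cong₂ (λ a b → a * b + S) d0≡1 (inv1-suc d n) ⟩
  1ℚ * (- S) + S
    ≡⟨ cancel S ⟩
  0ℚ ∎
  where
  S = sumTo n (λ i → d (suc i) * inv1 d (n ∸ i))
  cancel : ∀ x → 1ℚ * (- x) + x ≡ 0ℚ
  cancel = solve-∀ ℚ-ring

-- Substitution

-- Only the terms k ≤ n of Σₖ aₖ uᵏ are kept, which is right when u 0 ≡ 0.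
_∘ˢ_ : Series → Series → Series
(a ∘ˢ u) n = sumTo n (λ k → a k * pow u k n)

pow-vanish : ∀ u → u 0 ≡ 0ℚ → ∀ {k n} → n < k → pow u k n ≡ 0ℚ
pow-vanish u u0≡0 {suc k} {n} (s≤s n≤k) = sumTo-zero n term
  where
  term : ∀ i → i ≤ n → pow u k i * u (n ∸ i) ≡ 0ℚ
  term i i≤n with ℕ.m≤n⇒m<n∨m≡n i≤n
  ... | inj₁ i<n = trans (cong (_* u (n ∸ i)) (pow-vanish u u0≡0 (ℕ.<-≤-trans i<n n≤k))) (*-zeroˡ (u (n ∸ i)))
  ... | inj₂ refl = trans (cong (λ m → pow u k i * u m) (ℕ.n∸n≡0 i))
                          (trans (cong (pow u k i *_) u0≡0) (*-zeroʳ (pow u k i)))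

∘ˢ-extend : ∀ a u → u 0 ≡ 0ℚ → ∀ {n} m → n ≤ m → (a ∘ˢ u) n ≡ linComb m a (pow u) n
∘ˢ-extend a u u0≡0 m n≤m =
  sym (sumTo-extend m _ n≤m (λ k n<k → trans (cong (a k *_) (pow-vanish u u0≡0 n<k)) (*-zeroʳ (a k))))

∘ˢ-congˡ : ∀ {a b} u → a ≗ b → (a ∘ˢ u) ≗ (b ∘ˢ u)
∘ˢ-congˡ u a≗b n = sumTo-cong n (λ k → cong (_* pow u k n) (a≗b k))

∘ˢ-+ˢ : ∀ a b u → ((a +ˢ b) ∘ˢ u) ≗ (a ∘ˢ u) +ˢ (b ∘ˢ u)
∘ˢ-+ˢ a b u n = trans (sumTo-cong n (λ k → *-distribʳ-+ (pow u k n) (a k) (b k))) (sumTo-+ n _ _)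

1ˢ-∘ˢ : ∀ u → (1ˢ ∘ˢ u) ≗ 1ˢ
1ˢ-∘ˢ u zero    = *-identityˡ 1ℚ
1ˢ-∘ˢ u (suc n) = begin
  (1ˢ ∘ˢ u) (suc n)                                   ≡⟨ sumTo-shift n _ ⟩
  1ℚ * 0ℚ + sumTo n (λ k → 0ℚ * pow u (suc k) (suc n)) ≡⟨ cong (1ℚ * 0ℚ +_) (sumTo-zero n (λ k _ → *-zeroˡ (pow u (suc k) (suc n)))) ⟩
  1ℚ * 0ℚ + 0ℚ                                        ≡⟨⟩
  0ℚ                                                  ∎

∘ˢ-⊛ : ∀ a u → u 0 ≡ 0ℚ → ∀ g n → ((a ∘ˢ u) ⊛ g) n ≡ linComb n a (λ k → pow u k ⊛ g) n
∘ˢ-⊛ a u u0≡0 g n =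
  trans (sumTo-cong-≤ n (λ i i≤n → cong (_* g (n ∸ i)) (∘ˢ-extend a u u0≡0 n i≤n)))
        (⊛-linCombˡ n a (pow u) g n)

∘ˢ-⊛-self : ∀ a u → u 0 ≡ 0ℚ → ((a ∘ˢ u) ⊛ u) ≗ ((X· a) ∘ˢ u)
∘ˢ-⊛-self a u u0≡0 n = begin
  ((a ∘ˢ u) ⊛ u) n                                       ≡⟨ ∘ˢ-⊛ a u u0≡0 u n ⟩
  sumTo n (λ k → a k * pow u (suc k) n)                   ≡⟨ +-identityˡ _ ⟨
  0ℚ + sumTo n (λ k → a k * pow u (suc k) n)              ≡⟨ cong (_+ sumTo n (λ k → a k * pow u (suc k) n)) (*-zeroˡ (pow u 0 n)) ⟨
  0ℚ * pow u 0 n + sumTo n (λ k → a k * pow u (suc k) n)  ≡⟨ sumTo-shift n (λ k → (X· a) k * pow u k n) ⟨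
  linComb (suc n) (X· a) (pow u) n                        ≡⟨ ∘ˢ-extend (X· a) u u0≡0 (suc n) (ℕ.n≤1+n n) ⟨
  ((X· a) ∘ˢ u) n                                         ∎

Dλ-∘ˢ : ∀ λ' a u → u 0 ≡ 0ℚ → Dλ λ' (a ∘ˢ u) ≗ ((∂ a ∘ˢ u) ⊛ Dλ λ' u)
Dλ-∘ˢ λ' a u u0≡0 n = begin
  Dλ λ' (a ∘ˢ u) n
    ≡⟨ cong (λ z → ∂ (a ∘ˢ u) n + λ' * (ℕ→ℚ n * z)) (∘ˢ-extend a u u0≡0 (suc n) (ℕ.n≤1+n n)) ⟩
  Dλ λ' (linComb (suc n) a (pow u)) n
    ≡⟨ Dλ-linComb λ' (suc n) a (pow u) n ⟩
  linComb (suc n) a (λ k → Dλ λ' (pow u k)) n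
    ≡⟨ sumTo-shift n (λ k → a k * Dλ λ' (pow u k) n) ⟩
  a 0 * Dλ λ' (pow u 0) n + sumTo n (λ k → a (suc k) * Dλ λ' (pow u (suc k)) n)
    ≡⟨ cong₂ _+_ constant-term (sumTo-cong n power-rule) ⟩
  0ℚ + linComb n (∂ a) (λ k → pow u k ⊛ Dλ λ' u) n
    ≡⟨ +-identityˡ _ ⟩
  linComb n (∂ a) (λ k → pow u k ⊛ Dλ λ' u) n
    ≡⟨ ∘ˢ-⊛ (∂ a) u u0≡0 (Dλ λ' u) n ⟨
  ((∂ a ∘ˢ u) ⊛ Dλ λ' u) n ∎
  where
  constant-term : a 0 * Dλ λ' (pow u 0) n ≡ 0ℚ
  constant-term = trans (cong (a 0 *_) (trans (Dλ-cong λ' (pow-zero u) n) (Dλ-1ˢ λ' n))) (*-zeroʳ (a 0))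
  reassoc : ∀ a s p → a * (s * p) ≡ s * a * p
  reassoc = solve-∀ ℚ-ring
  power-rule : ∀ k → a (suc k) * Dλ λ' (pow u (suc k)) n ≡ ∂ a k * (pow u k ⊛ Dλ λ' u) n
  power-rule k = trans (cong (a (suc k) *_) (Dλ-pow λ' u k n)) (reassoc (a (suc k)) (ℕ→ℚ (suc k)) _)

-- The logarithm

log[1+X]/X : Series
log[1+X]/X k = sgn k * inv-suc k

∂-log[1+X] : ∂ (X· log[1+X]/X) ≗ sgn
∂-log[1+X] k = begin
  ℕ→ℚ (suc k) * (sgn k * inv-suc k)   ≡⟨ reassoc (ℕ→ℚ (suc k)) (sgn k) (inv-suc k) ⟩
  sgn k * (ℕ→ℚ (suc k) * inv-suc k)   ≡⟨ cong (sgn k *_) (suc-*-inv-suc k) ⟩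
  sgn k * 1ℚ                          ≡⟨ *-identityʳ (sgn k) ⟩
  sgn k                               ∎
  where
  reassoc : ∀ m s i → m * (s * i) ≡ s * (m * i)
  reassoc = solve-∀ ℚ-ring

sgn+X·sgn : sgn +ˢ X· sgn ≗ 1ˢ
sgn+X·sgn zero    = refl
sgn+X·sgn (suc k) = cancel (sgn k)
  where
  cancel : ∀ s → s * (- 1ℚ) + s ≡ 0ℚ
  cancel = solve-∀ ℚ-ring

-- X· logOverλt λ' is log(1 + λt)/λ.
Dλ-logOverλt : ∀ λ' → Dλ λ' (X· logOverλt λ') ≗ 1ˢ
Dλ-logOverλt λ' zero    = vanish λ'
  where
  vanish : ∀ l → 1ℚ * (1ℚ * 1ℚ) + l * (0ℚ * 0ℚ) ≡ 1ℚ
  vanish = solve-∀ ℚ-ring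
Dλ-logOverλt λ' (suc m) = begin
  ℕ→ℚ (suc (suc m)) * (p * (- λ') * inv-suc (suc m)) + λ' * (ℕ→ℚ (suc m) * (p * inv-suc m))
    ≡⟨ reassoc (ℕ→ℚ (suc (suc m))) (inv-suc (suc m)) (ℕ→ℚ (suc m)) (inv-suc m) p λ' ⟩
  (ℕ→ℚ (suc (suc m)) * inv-suc (suc m)) * (p * (- λ')) + (ℕ→ℚ (suc m) * inv-suc m) * (λ' * p)
    ≡⟨ cong₂ (λ a b → a * (p * (- λ')) + b * (λ' * p)) (suc-*-inv-suc (suc m)) (suc-*-inv-suc m) ⟩
  1ℚ * (p * (- λ')) + 1ℚ * (λ' * p)
    ≡⟨ cancel p λ' ⟩
  0ℚ ∎
  where
  p = (- λ') ^ m
  reassoc : ∀ s₂ i₂ s₁ i₁ p l → s₂ * (p * (- l) * i₂) + l * (s₁ * (p * i₁)) ≡ (s₂ * i₂) * (p * (- l)) + (s₁ * i₁) * (l * p)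
  reassoc = solve-∀ ℚ-ring
  cancel : ∀ p l → 1ℚ * (p * (- l)) + 1ℚ * (l * p) ≡ 0ℚ
  cancel = solve-∀ ℚ-ring

log[1+X]-∘ˢ : ∀ λ' u → u 0 ≡ 0ℚ → Dλ λ' u ≗ 1ˢ +ˢ u → (X· log[1+X]/X) ∘ˢ u ≗ X· logOverλt λ'
log[1+X]-∘ˢ λ' u u0≡0 Du≗1+u = Dλ-injective λ' refl (λ n → trans (Dλ-log n) (sym (Dλ-logOverλt λ' n)))
  where
  Dλ-log : Dλ λ' ((X· log[1+X]/X) ∘ˢ u) ≗ 1ˢ
  Dλ-log n = begin
    Dλ λ' ((X· log[1+X]/X) ∘ˢ u) n
      ≡⟨ Dλ-∘ˢ λ' (X· log[1+X]/X) u u0≡0 n ⟩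
    ((∂ (X· log[1+X]/X) ∘ˢ u) ⊛ Dλ λ' u) n
      ≡⟨ ⊛-cong (∘ˢ-congˡ u ∂-log[1+X]) Du≗1+u n ⟩
    ((sgn ∘ˢ u) ⊛ (1ˢ +ˢ u)) n
      ≡⟨ ⊛-distribˡ-+ˢ (sgn ∘ˢ u) 1ˢ u n ⟩
    ((sgn ∘ˢ u) ⊛ 1ˢ) n + ((sgn ∘ˢ u) ⊛ u) n
      ≡⟨ cong₂ _+_ (⊛-identityʳ (sgn ∘ˢ u) n) (∘ˢ-⊛-self sgn u u0≡0 n) ⟩
    (sgn ∘ˢ u) n + ((X· sgn) ∘ˢ u) n
      ≡⟨ ∘ˢ-+ˢ sgn (X· sgn) u n ⟨
    ((sgn +ˢ X· sgn) ∘ˢ u) n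
      ≡⟨ ∘ˢ-congˡ u sgn+X·sgn n ⟩
    (1ˢ ∘ˢ u) n
      ≡⟨ 1ˢ-∘ˢ u n ⟩
    1ˢ n ∎

βgen-0 : ∀ λ' → βgen λ' 0ℚ ≗ log[1+X]/X ∘ˢ eλ-1 λ'
βgen-0 λ' n = begin
  ((logOverλt λ' ⊛ I) ⊛ eλ λ' 0ℚ) n  ≡⟨ ⊛-congʳ (logOverλt λ' ⊛ I) (eλ-0 λ') n ⟩
  ((logOverλt λ' ⊛ I) ⊛ 1ˢ) n        ≡⟨ ⊛-identityʳ (logOverλt λ' ⊛ I) n ⟩
  (logOverλt λ' ⊛ I) n               ≡⟨ ⊛-congˡ I G⊛D≗logOverλt n ⟨
  ((G ⊛ D) ⊛ I) n                    ≡⟨ ⊛-assoc G D I n ⟩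
  (G ⊛ (D ⊛ I)) n                    ≡⟨ ⊛-congʳ G (⊛-inv1 D (D0≡1 λ')) n ⟩
  (G ⊛ 1ˢ) n                         ≡⟨ ⊛-identityʳ G n ⟩
  G n                                ∎
  where
  u = eλ-1 λ'
  D = eλ-1-over-t λ'
  I = inv1 D
  G = log[1+X]/X ∘ˢ u
  D0≡1 : ∀ l → 1ℚ * (1ℚ - 0ℚ * l) * 1ℚ ≡ 1ℚ
  D0≡1 = solve-∀ ℚ-ring
  G⊛D≗logOverλt : (G ⊛ D) ≗ logOverλt λ'
  G⊛D≗logOverλt m = begin
    (G ⊛ D) m                            ≡⟨ ⊛-X·ʳ G D (suc m) ⟨
    (G ⊛ X· D) (suc m)                   ≡⟨ ⊛-congʳ G (X·-tail u refl) (suc m) ⟨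
    (G ⊛ u) (suc m)                      ≡⟨ ∘ˢ-⊛-self log[1+X]/X u refl (suc m) ⟩
    ((X· log[1+X]/X) ∘ˢ u) (suc m)       ≡⟨ log[1+X]-∘ˢ λ' u refl Du≗1+u (suc m) ⟩
    logOverλt λ' m                       ∎
    where
    Du≗1+u : Dλ λ' u ≗ 1ˢ +ˢ u
    Du≗1+u k = trans (Dλ-eλ-1 λ' k) (eλ≗1ˢ+eλ-1 λ' k)

βnum-expansion : ∀ λ' n → βnum λ' n ≡ sumTo n (λ k → ℕ→ℚ (n !) * (sgn k * inv-suc k * pow (eλ-1 λ') k n))
βnum-expansion λ' n = trans (cong (ℕ→ℚ (n !) *_) (βgen-0 λ' n)) (sumTo-*ˡ n (ℕ→ℚ (n !)) _)

βnum-S2λ : ∀ λ' n → βnum λ' n ≡ sumTo n (λ k → sgn k * inv-suc k * ℕ→ℚ (k !) * S2λ λ' n k)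
βnum-S2λ λ' n = trans (βnum-expansion λ' n) (sumTo-cong n term)
  where
  reassoc : ∀ N s i p f j → N * (s * i * p) * (f * j) ≡ s * i * f * (N * (j * p))
  reassoc = solve-∀ ℚ-ring
  term : ∀ k → ℕ→ℚ (n !) * (sgn k * inv-suc k * pow (eλ-1 λ') k n) ≡ sgn k * inv-suc k * ℕ→ℚ (k !) * S2λ λ' n k
  term k = begin
    ℕ→ℚ (n !) * (sgn k * inv-suc k * p)                              ≡⟨ *-identityʳ _ ⟨
    ℕ→ℚ (n !) * (sgn k * inv-suc k * p) * 1ℚ                         ≡⟨ cong (ℕ→ℚ (n !) * (sgn k * inv-suc k * p) *_) (!-*-inv-fact k) ⟨
    ℕ→ℚ (n !) * (sgn k * inv-suc k * p) * (ℕ→ℚ (k !) * inv-fact k)   ≡⟨ reassoc (ℕ→ℚ (n !)) (sgn k) (inv-suc k) p (ℕ→ℚ (k !)) (inv-fact k) ⟩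
    sgn k * inv-suc k * ℕ→ℚ (k !) * S2λ λ' n k                       ∎
    where
    p = pow (eλ-1 λ') k n

βnum-dff : ∀ λ' n →
           βnum λ' n ≡ sumTo n (λ k → inv-suc k * sumTo k (λ j → ℕ→ℚ (k C j) * sgn j * dff (ℕ→ℚ j) λ' n))
βnum-dff λ' n = trans (βnum-expansion λ' n) (sumTo-cong n term)
  where
  e = eλ λ' 1ℚ
  reassoc : ∀ N s i p → N * (s * i * p) ≡ i * (N * (s * p))
  reassoc = solve-∀ ℚ-ring
  swap : ∀ N c x → N * (c * x) ≡ c * (N * x)
  swap = solve-∀ ℚ-ring
  term : ∀ k → ℕ→ℚ (n !) * (sgn k * inv-suc k * pow (eλ-1 λ') k n)
             ≡ inv-suc k * sumTo k (λ j → ℕ→ℚ (k C j) * sgn j * dff (ℕ→ℚ j) λ' n)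
  term k = begin
    ℕ→ℚ (n !) * (sgn k * inv-suc k * pow (eλ-1 λ') k n)
      ≡⟨ reassoc (ℕ→ℚ (n !)) (sgn k) (inv-suc k) _ ⟩
    inv-suc k * (ℕ→ℚ (n !) * (sgn k * pow (eλ-1 λ') k n))
      ≡⟨ cong (λ z → inv-suc k * (ℕ→ℚ (n !) * z)) (binomial e (eλ-1 λ') (eλ≗1ˢ+eλ-1 λ') k n) ⟨
    inv-suc k * (ℕ→ℚ (n !) * sumTo k (λ j → ℕ→ℚ (k C j) * sgn j * pow e j n))
      ≡⟨ cong (inv-suc k *_) (sumTo-*ˡ k (ℕ→ℚ (n !)) _) ⟩
    inv-suc k * sumTo k (λ j → ℕ→ℚ (n !) * (ℕ→ℚ (k C j) * sgn j * pow e j n))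
      ≡⟨ cong (inv-suc k *_) (sumTo-cong k coefficient) ⟩
    inv-suc k * sumTo k (λ j → ℕ→ℚ (k C j) * sgn j * dff (ℕ→ℚ j) λ' n) ∎
    where
    coefficient : ∀ j → ℕ→ℚ (n !) * (ℕ→ℚ (k C j) * sgn j * pow e j n) ≡ ℕ→ℚ (k C j) * sgn j * dff (ℕ→ℚ j) λ' n
    coefficient j = begin
      ℕ→ℚ (n !) * (ℕ→ℚ (k C j) * sgn j * pow e j n)         ≡⟨ swap (ℕ→ℚ (n !)) (ℕ→ℚ (k C j) * sgn j) (pow e j n) ⟩
      ℕ→ℚ (k C j) * sgn j * (ℕ→ℚ (n !) * pow e j n)         ≡⟨ cong (λ z → ℕ→ℚ (k C j) * sgn j * (ℕ→ℚ (n !) * z)) (eλ-ℕ λ' j n) ⟨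
      ℕ→ℚ (k C j) * sgn j * (ℕ→ℚ (n !) * eλ λ' (ℕ→ℚ j) n)  ≡⟨ cong (ℕ→ℚ (k C j) * sgn j *_) (n!-*-eλ λ' (ℕ→ℚ j) n) ⟩
      ℕ→ℚ (k C j) * sgn j * dff (ℕ→ℚ j) λ' n                ∎

theorem1 : (λ' : ℚ) (n : ℕ) →
    (βnum λ' n ≡ sumTo n (λ k → sgn k * inv-suc k * ℕ→ℚ (k !) * S2λ λ' n k))
    × (βnum λ' n ≡ sumTo n (λ k → inv-suc k * sumTo k (λ j → ℕ→ℚ (k C j) * sgn j * dff (ℕ→ℚ j) λ' n)))
theorem1 λ' n = βnum-S2λ λ' n , βnum-dff λ' n
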